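{- Let $(X,\Sigma,\to,\leq)$ be a labelled transition system with a quasi-ordering $\leq$ on $X$. Then it is monotone if and only if, for every $x_0\in X$, the system $(X,\Sigma,\to,\leq,x_0)$ is cover-monotone.
   Context: Monotone: for all $x,y,x'\in X$ with $x\leq y$ and $x\to x'$ there exists $y'$ with $y\xrightarrow{*}y'$ and $x'\leq y'$ (here $x\to x'$ means $x\xrightarrow{a}x'$ for some $a\in\Sigma$ and $\xrightarrow{*}$ is its reflexive-transitive closure). For a system with initial state $x_0$, $\mathrm{Cover}(x_0)=\downarrow\mathrm{Post}^*(x_0)=\{z\mid z\leq y\text{ for some }y\text{ with }x_0\xrightarrow{*}y\}$. The system $(X,\Sigma,\to,\leq,x_0)$ is cover-monotone if for all $y_1\in\mathrm{Cover}(x_0)$ and all $x_1,x_2\in X$ with $x_1\leq y_1$ and $x_1\to x_2$, there exists $y_2\in X$ with $y_1\xrightarrow{*}y_2$ and $x_2\leq y_2$. -}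

module Defs where

open import Level using (Level; _⊔_; suc)
open import Data.Product using (Σ; ∃; _×_; _,_)
open import Relation.Binary.Core using (Rel; _⇒_)
open import Relation.Binary.PropositionalEquality using (_≡_)
open import Relation.Binary.Structures using (IsPreorder)
open import Relation.Binary.Construct.Closure.ReflexiveTransitive using (Star)

record QLTS (a b c d : Level) : Set (suc (a ⊔ b ⊔ c ⊔ d)) where
  field
    X        : Set a
    Label    : Set b
    Step     : X → Label → X → Set c
    _≤_      : Rel X d
    isQuasiOrder : IsPreorder _≡_ _≤_

  _⟶_ : Rel X (b ⊔ c)
  x ⟶ x' = Σ Label (λ l → Step x l x')

  _⟶*_ : Rel X (a ⊔ b ⊔ c)
  _⟶*_ = Star _⟶_

  Monotone : Set (a ⊔ b ⊔ c ⊔ d)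
  Monotone = ∀ x y x' → x ≤ y → x ⟶ x' → ∃ λ y' → (y ⟶* y') × (x' ≤ y')

  Cover : X → X → Set (a ⊔ b ⊔ c ⊔ d)
  Cover x0 z = ∃ λ y → (x0 ⟶* y) × (z ≤ y)

  CoverMonotone : X → Set (a ⊔ b ⊔ c ⊔ d)
  CoverMonotone x0 = ∀ y1 → Cover x0 y1 → ∀ x1 x2 → x1 ≤ y1 → x1 ⟶ x2 →
                     ∃ λ y2 → (y1 ⟶* y2) × (x2 ≤ y2)

{-# OPTIONS --safe #-}
module Submission where

open import Defs
open import Level using (Level)
open import Function.Bundles using (_⇔_; mk⇔)
open import Data.Product using (_,_)
open import Relation.Binary.Structures using (IsPreorder)
open import Relation.Binary.Construct.Closure.ReflexiveTransitive using (ε)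

-- Monotonicity quantifies over all y, cover-monotonicity only over y ∈ Cover(x0);
-- since every y lies in Cover(y), choosing x0 := y recovers the unrestricted condition.

module _ {a b c d : Level} (S : QLTS a b c d) where
  open QLTS S

  Monotone⇒CoverMonotone : Monotone → ∀ x0 → CoverMonotone x0
  Monotone⇒CoverMonotone monotone x0 y1 _ x1 = monotone x1 y1

  Cover-self : ∀ y → Cover y y
  Cover-self y = y , ε , IsPreorder.refl isQuasiOrder

  CoverMonotone-self⇒Monotone : (∀ y → CoverMonotone y) → Monotone
  CoverMonotone-self⇒Monotone coverMonotone x y = coverMonotone y y (Cover-self y) x

proposition5p5 : ∀ {a b c d : Level} (S : QLTS a b c d) →
    QLTS.Monotone S ⇔ (∀ x0 → QLTS.CoverMonotone S x0)
proposition5p5 S = mk⇔ (Monotone⇒CoverMonotone S) (CoverMonotone-self⇒Monotone S)
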